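{- Let $k\ge2$ be an integer, $\epsilon,\delta>0$, $t\ge1$ an integer, $0\le\zeta\le\epsilon/(2t)$, and $L\ge1$ an integer. Let $\mathcal{L}=(G(V,W,E),[R],\{\pi_{v,w}\})$ be a Unique Games instance and $H_{\mathrm{DVD}}$ the layered graph constructed from it as in the context. If there is a labeling $\rho$ of $\mathcal{L}$ satisfying at least a $1-\zeta$ fraction of the constraints, then the set $T$ of test-vertices can be partitioned into $T',T_0,\dots,T_{k-1}$ with $|T_j|\ge\frac{1-2\epsilon}{k}|T|$ for every $j$ and $|T'|\le2\epsilon|T|$, such that for every $j\in[k]$ the graph obtained from $H_{\mathrm{DVD}}$ by deleting $T'\cup T_j$ has no directed path containing $k$ test-vertices.
   Context: A Unique Games instance consists of a regular bipartite graph $G(V,W,E)$, a label set $[R]$, and for each edge $(v,w)$ a permutation $\pi_{v,w}$ of $[R]$; a labeling $\rho$ satisfies $(v,w)$ if $\rho(v)=\pi_{v,w}(\rho(w))$. $N(v)$ is the set of neighbors of $v$. $[k]=\{0,\dots,k-1\}$, $\oplus$ is coordinatewise addition mod $k$, $\epsilon R$ is integral, $S$ ranges over $[R]^{\epsilon R}$. For an edge $(v,w)$: $C_{x,S,v,w}=\{z\in[k]^R: z_j=x_{\pi_{v,w}(j)}\ \forall j\text{ with }\pi_{v,w}(j)\notin S\}$, $C^\oplus_{x,S,v,w}=\{z\oplus1:z\in C_{x,S,v,w}\}$. $H_{\mathrm{DVD}}$: bit-vertices $b^\ell_{w,x}$ for $\ell=0,\dots,L$, $w\in W$, $x\in[k]^R$;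 test-vertices $t^{\ell'}_{x,S,v,w_1,\dots,w_{2t}}$ for $\ell'=0,\dots,L-1$, $x\in[k]^R$, $S\in[R]^{\epsilon R}$, $v\in V$, $(w_1,\dots,w_{2t})\in N(v)^{2t}$; for $j=1,\dots,2t$, an arc $b^\ell_{w_j,z}\to t^{\ell'}_{x,S,v,w_1,\dots,w_{2t}}$ if $\ell\le\ell'$ and $z\in C_{x,S,v,w_j}$, and an arc $t^{\ell'}_{x,S,v,w_1,\dots,w_{2t}}\to b^\ell_{w_j,z}$ if $\ell>\ell'$ and $z\in C^\oplus_{x,S,v,w_j}$. No other arcs. -}

module Defs where

open import Data.Nat as ℕ using (ℕ; zero; suc; _+_; _*_)
open import Data.Nat.DivMod using (_mod_)
open import Data.Fin as Fin using (Fin; toℕ)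
open import Data.Fin.Permutation using (Permutation′; _⟨$⟩ʳ_)
open import Data.Bool using (Bool; true; false; _∧_; if_then_else_)
open import Data.Maybe using (Maybe; just; nothing)
open import Data.Product using (Σ; ∃; _×_)
open import Data.Empty using (⊥)
open import Data.Unit using (⊤)
open import Data.List using (List; []; _∷_)
open import Data.Integer using (+_)
open import Data.Rational using (ℚ; _/_)
open import Relation.Nullary using (¬_; does)
open import Relation.Binary.PropositionalEquality using (_≡_; _≢_)

⟦_⟧ : ℕ → ℚ
⟦ n ⟧ = (+ n) / 1

Σfin : (n : ℕ) → (Fin n → ℕ) → ℕ
Σfin zero    f = 0
Σfin (suc n) f = f Fin.zero + Σfin n (λ i → f (Fin.suc i))

cons : ∀ {n k} → Fin k → (Fin n → Fin k) → (Fin (suc n) → Fin k)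
cons a g Fin.zero    = a
cons a g (Fin.suc i) = g i

Σfun : (n k : ℕ) → ((Fin n → Fin k) → ℕ) → ℕ
Σfun zero    k f = f (λ ())
Σfun (suc n) k f = Σfin k (λ a → Σfun n k (λ g → f (cons a g)))

allFin : (n : ℕ) → (Fin n → Bool) → Bool
allFin zero    f = true
allFin (suc n) f = f Fin.zero ∧ allFin n (λ i → f (Fin.suc i))

ind : Bool → ℕ
ind true  = 1
ind false = 0

inc : ∀ {k} → Fin k → Fin k
inc {suc k} i = suc (toℕ i) mod (suc k)

-- Unique Games instance  (G(V,W,E), [R], {π_{v,w}})
-- V = Fin nV, W = Fin nW, labels [R] = Fin R, E given by its (decidable)
-- adjacency relation, π v w the permutation on the edge (v,w).
record UG : Set where
  field
    nV nW R : ℕ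
    E  : Fin nV → Fin nW → Bool
    π  : Fin nV → Fin nW → Permutation′ R

module _ (U : UG) where
  open UG U

  degV : Fin nV → ℕ
  degV v = Σfin nW (λ w → ind (E v w))

  degW : Fin nW → ℕ
  degW w = Σfin nV (λ v → ind (E v w))

  Regular : Set
  Regular = Σ ℕ λ dV → Σ ℕ λ dW →
              (∀ v → degV v ≡ dV) × (∀ w → degW w ≡ dW)

  numEdges : ℕ
  numEdges = Σfin nV (λ v → Σfin nW (λ w → ind (E v w)))

  record Labeling : Set where
    field
      ρV : Fin nV → Fin R
      ρW : Fin nW → Fin R

  satB : Labeling → Fin nV → Fin nW → Bool
  satB ρ v w = does (Labeling.ρV ρ v Fin.≟ (π v w ⟨$⟩ʳ Labeling.ρW ρ w))

  numSat : Labeling → ℕ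
  numSat ρ = Σfin nV (λ v → Σfin nW (λ w → ind (E v w ∧ satB ρ v w)))

-- The graph H_DVD, with parameters k, t, m = εR, L.
module HDVD (k t m L : ℕ) (U : UG) where
  open UG U

  -- raw data of a test-vertex t^{ℓ'}_{x,S,v,w_1..w_{2t}};
  -- S ∈ [R]^{εR} is a tuple Fin m → Fin R, the w's a tuple Fin (2t) → W
  record TV : Set where
    constructor tv
    field
      ℓ' : Fin L
      x  : Fin R → Fin k
      S  : Fin m → Fin R
      v  : Fin nV
      ws : Fin (2 * t) → Fin nW

  open TV

  -- it is a test-vertex of H iff (w_1..w_{2t}) ∈ N(v)^{2t}
  validB : TV → Bool
  validB τ = allFin (2 * t) (λ i → E (v τ) (ws τ i))

  Valid : TV → Set
  Valid τ = validB τ ≡ true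

  ΣTV : (TV → ℕ) → ℕ
  ΣTV f = Σfin L λ l → Σfun R k λ x → Σfun m R λ S → Σfin nV λ v →
          Σfun (2 * t) nW λ ws → f (tv l x S v ws)

  countT : (TV → Bool) → ℕ
  countT P = ΣTV (λ τ → ind (validB τ ∧ P τ))

  sizeT : ℕ
  sizeT = countT (λ _ → true)

  InS : (Fin m → Fin R) → Fin R → Set
  InS S r = ∃ λ i → S i ≡ r

  InC : (Fin R → Fin k) → (Fin R → Fin k) → (Fin m → Fin R) →
        Fin nV → Fin nW → Set
  InC z x S v w = ∀ (j : Fin R) → ¬ InS S (π v w ⟨$⟩ʳ j) →
                  z j ≡ x (π v w ⟨$⟩ʳ j)

  InC⊕ : (Fin R → Fin k) → (Fin R → Fin k) → (Fin m → Fin R) →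
         Fin nV → Fin nW → Set
  InC⊕ z' x S v w = ∃ λ (z : Fin R → Fin k) →
                     InC z x S v w × (∀ j → z' j ≡ inc (z j))

  data Vertex : Set where
    bit  : Fin (suc L) → Fin nW → (Fin R → Fin k) → Vertex
    test : TV → Vertex

  Arc : Vertex → Vertex → Set
  Arc (bit ℓ w z) (test τ) =
    Σ (Fin (2 * t)) λ j → (w ≡ ws τ j) × (toℕ ℓ ℕ.≤ toℕ (ℓ' τ)) ×
                            InC z (x τ) (S τ) (v τ) (ws τ j)
  Arc (test τ) (bit ℓ w z) =
    Σ (Fin (2 * t)) λ j → (w ≡ ws τ j) × (toℕ (ℓ' τ) ℕ.< toℕ ℓ) ×
                            InC⊕ z (x τ) (S τ) (v τ) (ws τ j)
  Arc (bit _ _ _) (bit _ _ _) = ⊥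
  Arc (test _) (test _) = ⊥

  Consecutive : List Vertex → Set
  Consecutive []            = ⊤
  Consecutive (a ∷ [])      = ⊤
  Consecutive (a ∷ b ∷ ps)  = Arc a b × Consecutive (b ∷ ps)

  Distinct : List Vertex → Set
  Distinct []       = ⊤
  Distinct (a ∷ ps) = AllNe a ps × Distinct ps
    where
      AllNe : Vertex → List Vertex → Set
      AllNe a []       = ⊤
      AllNe a (b ∷ bs) = (a ≢ b) × AllNe a bs

  AllIn : (TV → Set) → List Vertex → Set
  AllIn Keep []               = ⊤
  AllIn Keep (bit _ _ _ ∷ ps) = AllIn Keep ps
  AllIn Keep (test τ ∷ ps)    = Keep τ × AllIn Keep ps

  numTests : List Vertex → ℕ
  numTests []               = 0
  numTests (bit _ _ _ ∷ ps) = numTests ps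
  numTests (test _ ∷ ps)    = suc (numTests ps)

  -- a directed path in the induced subgraph of H on bits ∪ {τ | Keep τ}
  record PathIn (Keep : TV → Set) : Set where
    field
      vertices : List Vertex
      arcs     : Consecutive vertices
      distinct : Distinct vertices
      inside   : AllIn Keep vertices

  -- A partition of T into T', T_0, …, T_{k-1} is given by a map
  -- part : TV → Maybe (Fin k)  (nothing ↦ T', just j ↦ T_j),
  -- only its values on valid test-vertices matter.
  isNothingB : Maybe (Fin k) → Bool
  isNothingB nothing  = true
  isNothingB (just _) = false

  isB : Fin k → Maybe (Fin k) → Bool
  isB j nothing   = false
  isB j (just j') = does (j Fin.≟ j')

  sizeT' : (TV → Maybe (Fin k)) → ℕ
  sizeT' part = countT (λ τ → isNothingB (part τ))

  sizeTj : (TV → Maybe (Fin k)) → Fin k → ℕ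
  sizeTj part j = countT (λ τ → isB j (part τ))

  KeptAfterDeleting : (TV → Maybe (Fin k)) → Fin k → TV → Set
  KeptAfterDeleting part j τ =
    Valid τ × (∃ λ j' → (part τ ≡ just j') × (j' ≢ j))

-- Let ρ be the labeling. Call a test-vertex t_{x,S,v,w₁…w_{2t}} good when every edge (v,wᵢ) is satisfied by ρ and
-- ρ(v) ∉ S; a good test-vertex goes to T_{x(ρ(v))}, all others to T'. For fixed (S,v,w) the colour x(ρ(v)) takes each
-- value for a 1/k fraction of the x, which gives |T_j| = (|T| − |T'|)/k. A test-vertex is bad only if ρ(v) ∈ S, which
-- by the union bound happens for at most a fraction m/R = ε of the S, or if some (v,wᵢ) is unsatisfied: when a is the
-- fraction of satisfied edges at v, this happens for a fraction 1 − a^{2t} ≤ 2t(1 − a) of the tuples w, which by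
-- regularity averages to at most 2tζ ≤ ε. Finally colour b_{w,z} by z(ρ(w)) and a test-vertex by x(ρ(v)): the colour
-- is kept along an arc into a good test-vertex and increases by 1 mod k along an arc out of it, so a path avoiding
-- T' ∪ T_j visits test-vertices of consecutive colours different from j, and there are fewer than k of them.

module Submission where

open import Data.Fin using (Fin)
open import Data.Nat using (ℕ; suc)
open import Defs

module FiniteSums where
  import Data.Fin as Fin
  open import Data.Nat using (zero; _+_; _*_; _^_; _∸_; _≤_)
  open import Data.Nat.Properties hiding (_≟_)
  open import Algebra.Properties.CommutativeSemigroup +-commutativeSemigroup using (interchange)
  open import Data.Product using (_×_; _,_)
  open import Function using (_∘_)
  open import Relation.Binary.PropositionalEquality

  record Additive {A : Set} (∑ : (A → ℕ) → ℕ) : Set where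
    field
      ∑-cong : ∀ {f g} → (∀ a → f a ≡ g a) → ∑ f ≡ ∑ g
      ∑-+    : ∀ f g → ∑ (λ a → f a + g a) ≡ ∑ f + ∑ g

    ∑-0 : ∑ (λ _ → 0) ≡ 0
    ∑-0 = sym (+-cancelˡ-≡ (∑ (λ _ → 0)) 0 _
            (trans (+-identityʳ _) (∑-+ (λ _ → 0) (λ _ → 0))))

    ∑-mono : ∀ {f g} → (∀ a → f a ≤ g a) → ∑ f ≤ ∑ g
    ∑-mono {f} {g} f≤g = begin
      ∑ f                          ≤⟨ m≤m+n (∑ f) _ ⟩
      ∑ f + ∑ (λ a → g a ∸ f a)    ≡⟨ ∑-+ f _ ⟨
      ∑ (λ a → f a + (g a ∸ f a))  ≡⟨ ∑-cong (λ a → m+[n∸m]≡n (f≤g a)) ⟩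
      ∑ g                          ∎
      where open ≤-Reasoning

    *-distribˡ-∑ : ∀ c f → c * ∑ f ≡ ∑ (λ a → c * f a)
    *-distribˡ-∑ zero    f = sym ∑-0
    *-distribˡ-∑ (suc c) f = trans (cong (∑ f +_) (*-distribˡ-∑ c f)) (sym (∑-+ f _))

    ∑-linear : ∀ c {f g h} → (∀ a → c * f a + g a ≡ h a) → c * ∑ f + ∑ g ≡ ∑ h
    ∑-linear c {f} {g} {h} eq = begin
      c * ∑ f + ∑ g              ≡⟨ cong (_+ ∑ g) (*-distribˡ-∑ c f) ⟩
      ∑ (λ a → c * f a) + ∑ g    ≡⟨ ∑-+ _ g ⟨
      ∑ (λ a → c * f a + g a)    ≡⟨ ∑-cong eq ⟩
      ∑ h                        ∎
      where open ≡-Reasoning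

    *-∑-mono : ∀ c d {f g} → (∀ a → c * f a ≤ d * g a) → c * ∑ f ≤ d * ∑ g
    *-∑-mono c d {f} {g} le = begin
      c * ∑ f              ≡⟨ *-distribˡ-∑ c f ⟩
      ∑ (λ a → c * f a)    ≤⟨ ∑-mono le ⟩
      ∑ (λ a → d * g a)    ≡⟨ *-distribˡ-∑ d g ⟨
      d * ∑ g              ∎
      where open ≤-Reasoning

  open Additive public

  infixr 5 _⊗_
  _⊗_ : {A B : Set} → ((A → ℕ) → ℕ) → ((B → ℕ) → ℕ) → (A × B → ℕ) → ℕ
  (∑₁ ⊗ ∑₂) f = ∑₁ λ a → ∑₂ λ b → f (a , b)

  ⊗-additive : {A B : Set} {∑₁ : (A → ℕ) → ℕ} {∑₂ : (B → ℕ) → ℕ} →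
               Additive ∑₁ → Additive ∑₂ → Additive (∑₁ ⊗ ∑₂)
  ⊗-additive add₁ add₂ = record
    { ∑-cong = λ f≗g → ∑-cong add₁ λ a → ∑-cong add₂ λ b → f≗g (a , b)
    ; ∑-+    = λ f g → trans (∑-cong add₁ λ a → ∑-+ add₂ _ _) (∑-+ add₁ _ _)
    }

  Σfin-cong : ∀ n {f g : Fin n → ℕ} → (∀ i → f i ≡ g i) → Σfin n f ≡ Σfin n g
  Σfin-cong zero    f≗g = refl
  Σfin-cong (suc n) f≗g = cong₂ _+_ (f≗g Fin.zero) (Σfin-cong n (f≗g ∘ Fin.suc))

  Σfin-+ : ∀ n (f g : Fin n → ℕ) → Σfin n (λ i → f i + g i) ≡ Σfin n f + Σfin n g
  Σfin-+ zero    f g = refl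
  Σfin-+ (suc n) f g =
    trans (cong (f Fin.zero + g Fin.zero +_) (Σfin-+ n (f ∘ Fin.suc) (g ∘ Fin.suc)))
          (interchange (f Fin.zero) (g Fin.zero) _ _)

  Σfin-additive : ∀ n → Additive (Σfin n)
  Σfin-additive n = record { ∑-cong = Σfin-cong n ; ∑-+ = Σfin-+ n }

  Σfin-const : ∀ n c → Σfin n (λ _ → c) ≡ n * c
  Σfin-const zero    c = refl
  Σfin-const (suc n) c = cong (c +_) (Σfin-const n c)

  Σfin-comm : {A : Set} {∑ : (A → ℕ) → ℕ} → Additive ∑ → ∀ n (f : Fin n → A → ℕ) →
              Σfin n (λ i → ∑ (f i)) ≡ ∑ (λ a → Σfin n (λ i → f i a))
  Σfin-comm add zero    f = sym (∑-0 add)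
  Σfin-comm {∑ = ∑} add (suc n) f =
    trans (cong (∑ (f Fin.zero) +_) (Σfin-comm add n (f ∘ Fin.suc))) (sym (∑-+ add _ _))

  Σfun-cong : ∀ n N {f g : (Fin n → Fin N) → ℕ} → (∀ x → f x ≡ g x) → Σfun n N f ≡ Σfun n N g
  Σfun-cong zero    N f≗g = f≗g _
  Σfun-cong (suc n) N f≗g = Σfin-cong N λ a → Σfun-cong n N λ x → f≗g (cons a x)

  Σfun-+ : ∀ n N (f g : (Fin n → Fin N) → ℕ) →
           Σfun n N (λ x → f x + g x) ≡ Σfun n N f + Σfun n N g
  Σfun-+ zero    N f g = refl
  Σfun-+ (suc n) N f g = trans (Σfin-cong N λ a → Σfun-+ n N _ _) (Σfin-+ N _ _)

  Σfun-additive : ∀ n N → Additive (Σfun n N)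
  Σfun-additive n N = record { ∑-cong = Σfun-cong n N ; ∑-+ = Σfun-+ n N }

  Σfun-const : ∀ n N c → Σfun n N (λ _ → c) ≡ N ^ n * c
  Σfun-const zero    N c = sym (+-identityʳ c)
  Σfun-const (suc n) N c = begin
    Σfin N (λ _ → Σfun n N (λ _ → c))  ≡⟨ Σfin-cong N (λ _ → Σfun-const n N c) ⟩
    Σfin N (λ _ → N ^ n * c)           ≡⟨ Σfin-const N (N ^ n * c) ⟩
    N * (N ^ n * c)                    ≡⟨ *-assoc N (N ^ n) c ⟨
    N ^ suc n * c                      ∎
    where open ≡-Reasoning

  Σfun-comm : {A : Set} {∑ : (A → ℕ) → ℕ} → Additive ∑ → ∀ n N (f : (Fin n → Fin N) → A → ℕ) →
              Σfun n N (λ x → ∑ (f x)) ≡ ∑ (λ a → Σfun n N (λ x → f x a))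
  Σfun-comm add zero    N f = refl
  Σfun-comm add (suc n) N f = trans (Σfin-cong N λ _ → Σfun-comm add n N _) (Σfin-comm add N _)

module Counting where
  open import Data.Bool using (Bool; true; false; _∧_; _∨_; not)
  open import Data.Fin as Fin using (_≟_)
  open import Data.Nat using (zero; _+_; _*_; _^_; _≤_; z≤n; s≤s)
  open import Data.Nat.Properties hiding (_≟_)
  open import Data.Nat.Solver using (module +-*-Solver)
  open import Data.Product using (_×_; _,_; proj₁; proj₂)
  open import Relation.Nullary using (¬_; Dec; yes; no; does)
  open import Relation.Binary.PropositionalEquality
  open FiniteSums
  open +-*-Solver using (solve; _:=_; _:+_; _:*_; con)

  anyFin : (n : ℕ) → (Fin n → Bool) → Bool
  anyFin zero    f = false
  anyFin (suc n) f = f Fin.zero ∨ anyFin n (λ i → f (Fin.suc i))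

  ∧-true : ∀ {a b} → (a ∧ b) ≡ true → a ≡ true × b ≡ true
  ∧-true {true} {true} _ = refl , refl

  not-true : ∀ {a} → not a ≡ true → a ≡ false
  not-true {false} _ = refl

  allFin-true : ∀ n {p : Fin n → Bool} → allFin n p ≡ true → ∀ i → p i ≡ true
  allFin-true (suc n) all-p Fin.zero    = proj₁ (∧-true all-p)
  allFin-true (suc n) all-p (Fin.suc i) = allFin-true n (proj₂ (∧-true all-p)) i

  anyFin-false : ∀ n {p : Fin n → Bool} → anyFin n p ≡ false → ∀ i → p i ≡ false
  anyFin-false (suc n) {p} no-p i with p Fin.zero in p0≡
  anyFin-false (suc n) no-p Fin.zero    | false = p0≡
  anyFin-false (suc n) no-p (Fin.suc i) | false = anyFin-false n no-p i

  does-true : ∀ {P : Set} (d : Dec P) → does d ≡ true → P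
  does-true (yes p) _ = p

  does-false : ∀ {P : Set} (d : Dec P) → does d ≡ false → ¬ P
  does-false (no ¬p) _ = ¬p

  ind-∧ : ∀ a b → ind (a ∧ b) ≡ ind a * ind b
  ind-∧ true  b = sym (+-identityʳ (ind b))
  ind-∧ false b = refl

  ind-∨ : ∀ a b → ind (a ∨ b) ≤ ind a + ind b
  ind-∨ true  b = s≤s z≤n
  ind-∨ false b = ≤-refl

  ind-∧-not-+ : ∀ a b → ind (a ∧ not b) + ind (a ∧ b) ≡ ind a
  ind-∧-not-+ true  true  = refl
  ind-∧-not-+ true  false = refl
  ind-∧-not-+ false b     = refl

  allFin-∧ : ∀ n (p q : Fin n → Bool) → (allFin n p ∧ allFin n q) ≡ allFin n (λ i → p i ∧ q i)
  allFin-∧ zero    p q = refl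
  allFin-∧ (suc n) p q with p Fin.zero | q Fin.zero
  ... | false | _     = refl
  ... | true  | true  = allFin-∧ n _ _
  ... | true  | false with allFin n (λ i → p (Fin.suc i))
  ...   | true  = refl
  ...   | false = refl

  Σfin-ind-≟ : ∀ N (j : Fin N) → Σfin N (λ a → ind (does (j ≟ a))) ≡ 1
  Σfin-ind-≟ (suc N) Fin.zero    = cong suc (∑-0 (Σfin-additive N))
  Σfin-ind-≟ (suc N) (Fin.suc j) = Σfin-ind-≟ N j

  Σfun-ind-allFin : ∀ n N (h : Fin N → Bool) →
                    Σfun n N (λ x → ind (allFin n (λ i → h (x i)))) ≡ Σfin N (λ a → ind (h a)) ^ n
  Σfun-ind-allFin zero    N h = refl
  Σfun-ind-allFin (suc n) N h = begin
    Σfin N (λ a → Σfun n N (λ x → ind (h a ∧ allFin n (λ i → h (x i)))))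
      ≡⟨ Σfin-cong N (λ a → Σfun-cong n N (λ x → ind-∧ (h a) _)) ⟩
    Σfin N (λ a → Σfun n N (λ x → ind (h a) * ind (allFin n (λ i → h (x i)))))
      ≡⟨ Σfin-cong N (λ a → sym (*-distribˡ-∑ (Σfun-additive n N) (ind (h a)) _)) ⟩
    Σfin N (λ a → ind (h a) * Σfun n N (λ x → ind (allFin n (λ i → h (x i)))))
      ≡⟨ Σfin-cong N (λ a → cong (ind (h a) *_) (Σfun-ind-allFin n N h)) ⟩
    Σfin N (λ a → ind (h a) * H ^ n)
      ≡⟨ Σfin-cong N (λ a → *-comm (ind (h a)) (H ^ n)) ⟩
    Σfin N (λ a → H ^ n * ind (h a))
      ≡⟨ *-distribˡ-∑ (Σfin-additive N) (H ^ n) _ ⟨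
    H ^ n * H
      ≡⟨ *-comm (H ^ n) H ⟩
    H ^ suc n ∎
    where
    open ≡-Reasoning
    H : ℕ
    H = Σfin N (λ a → ind (h a))

  *-Σfun-coordinate : ∀ n N (f : Fin N → ℕ) (r : Fin n) →
                      N * Σfun n N (λ x → f (x r)) ≡ N ^ n * Σfin N f
  *-Σfun-coordinate (suc n) N f Fin.zero = begin
    N * Σfin N (λ a → Σfun n N (λ _ → f a))  ≡⟨ cong (N *_) (Σfin-cong N (λ a → Σfun-const n N (f a))) ⟩
    N * Σfin N (λ a → N ^ n * f a)           ≡⟨ cong (N *_) (*-distribˡ-∑ (Σfin-additive N) (N ^ n) f) ⟨
    N * (N ^ n * Σfin N f)                   ≡⟨ *-assoc N (N ^ n) _ ⟨
    N ^ suc n * Σfin N f                     ∎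
    where open ≡-Reasoning
  *-Σfun-coordinate (suc n) N f (Fin.suc r) = begin
    N * Σfin N (λ _ → Σfun n N (λ x → f (x r)))  ≡⟨ cong (N *_) (Σfin-const N _) ⟩
    N * (N * Σfun n N (λ x → f (x r)))           ≡⟨ cong (N *_) (*-Σfun-coordinate n N f r) ⟩
    N * (N ^ n * Σfin N f)                       ≡⟨ *-assoc N (N ^ n) _ ⟨
    N ^ suc n * Σfin N f                         ∎
    where open ≡-Reasoning

  *-Σfun-ind-anyFin-≤ : ∀ n N (h : Fin N → Bool) →
                        N * Σfun n N (λ x → ind (anyFin n (λ i → h (x i))))
                          ≤ n * (N ^ n * Σfin N (λ a → ind (h a)))
  *-Σfun-ind-anyFin-≤ zero    N h = ≤-reflexive (*-zeroʳ N)
  *-Σfun-ind-anyFin-≤ (suc n) N h = begin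
    N * Σfin N (λ a → Σfun n N (λ x → ind (h a ∨ any x)))
      ≤⟨ *-monoʳ-≤ N (∑-mono (Σfin-additive N) λ a →
                       ∑-mono (Σfun-additive n N) λ x → ind-∨ (h a) (any x)) ⟩
    N * Σfin N (λ a → Σfun n N (λ x → ind (h a) + ind (any x)))
      ≡⟨ cong (N *_) (Σfin-cong N λ a → trans (Σfun-+ n N _ _) (cong (_+ C) (Σfun-const n N _))) ⟩
    N * Σfin N (λ a → N ^ n * ind (h a) + C)
      ≡⟨ cong (N *_) (trans (Σfin-+ N _ _)
           (cong₂ _+_ (sym (*-distribˡ-∑ (Σfin-additive N) (N ^ n) _)) (Σfin-const N C))) ⟩
    N * (N ^ n * H + N * C)
      ≤⟨ *-monoʳ-≤ N (+-monoʳ-≤ (N ^ n * H) (*-Σfun-ind-anyFin-≤ n N h)) ⟩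
    N * (N ^ n * H + n * (N ^ n * H))
      ≡⟨ solve 4 (λ N P H n → N :* (P :* H :+ n :* (P :* H)) := (con 1 :+ n) :* (N :* P :* H))
               refl N (N ^ n) H n ⟩
    suc n * (N ^ suc n * H) ∎
    where
    open ≤-Reasoning
    any : (Fin n → Fin N) → Bool
    any x = anyFin n (λ i → h (x i))
    C H : ℕ
    C = Σfun n N (λ x → ind (any x))
    H = Σfin N (λ a → ind (h a))

  [s+u]^[1+e]≤s^[1+e]+[1+e]*[s+u]^e*u : ∀ e s u →
    (s + u) ^ suc e ≤ s ^ suc e + suc e * (s + u) ^ e * u
  [s+u]^[1+e]≤s^[1+e]+[1+e]*[s+u]^e*u zero s u =
    ≤-reflexive (solve 2 (λ s u → (s :+ u) :* con 1 := s :* con 1 :+ (con 1 :+ con 0) :* con 1 :* u)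
                         refl s u)
  [s+u]^[1+e]≤s^[1+e]+[1+e]*[s+u]^e*u (suc e) s u = begin
    d * d ^ suc e                           ≤⟨ *-monoʳ-≤ d ([s+u]^[1+e]≤s^[1+e]+[1+e]*[s+u]^e*u e s u) ⟩
    d * (s ^ suc e + suc e * d ^ e * u)     ≡⟨ solve 5 (λ s u P Q e →
        (s :+ u) :* (P :+ (con 1 :+ e) :* Q :* u) := s :* P :+ u :* P :+ (con 1 :+ e) :* ((s :+ u) :* Q) :* u)
        refl s u (s ^ suc e) (d ^ e) e ⟩
    s ^ suc (suc e) + u * s ^ suc e + suc e * d ^ suc e * u
      ≤⟨ +-monoˡ-≤ _ (+-monoʳ-≤ (s ^ suc (suc e)) (*-monoʳ-≤ u (^-monoˡ-≤ (suc e) (m≤m+n s u)))) ⟩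
    s ^ suc (suc e) + u * d ^ suc e + suc e * d ^ suc e * u
      ≡⟨ solve 4 (λ S u D e → S :+ u :* D :+ (con 1 :+ e) :* D :* u := S :+ (con 1 :+ (con 1 :+ e)) :* D :* u)
           refl (s ^ suc (suc e)) u (d ^ suc e) e ⟩
    s ^ suc (suc e) + suc (suc e) * d ^ suc e * u ∎
    where
    open ≤-Reasoning
    d : ℕ
    d = s + u

  ^-deficit-≤ : ∀ e s u b → b + s ^ suc e ≡ (s + u) ^ suc e →
                b + suc e * (s + u) ^ e * s ≤ suc e * (s + u) ^ e * (s + u)
  ^-deficit-≤ e s u b b+s^≡d^ = begin
    b + c * s      ≤⟨ +-monoˡ-≤ (c * s) b≤c*u ⟩
    c * u + c * s  ≡⟨ +-comm (c * u) (c * s) ⟩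
    c * s + c * u  ≡⟨ *-distribˡ-+ c s u ⟨
    c * (s + u)    ∎
    where
    open ≤-Reasoning
    c : ℕ
    c = suc e * (s + u) ^ e
    b≤c*u : b ≤ c * u
    b≤c*u = +-cancelʳ-≤ (s ^ suc e) b (c * u) (begin
      b + s ^ suc e      ≡⟨ b+s^≡d^ ⟩
      (s + u) ^ suc e    ≤⟨ [s+u]^[1+e]≤s^[1+e]+[1+e]*[s+u]^e*u e s u ⟩
      s ^ suc e + c * u  ≡⟨ +-comm (s ^ suc e) (c * u) ⟩
      c * u + s ^ suc e  ∎)

module NaturalsInRationals where
  import Data.Nat as ℕ
  open import Data.Nat.Coprimality as Coprime using (1-coprimeTo)
  open import Data.Integer as ℤ using (+_)
  import Data.Integer.Properties as ℤ
  open import Data.Rational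
  open import Data.Rational.Properties
  open import Data.Rational.Solver using (module +-*-Solver)
  open import Relation.Binary.PropositionalEquality
  open +-*-Solver using (solve; _:=_; _:+_; _:*_; _:-_; con)

  ⟦⟧-mkℚ : ∀ n → ⟦ n ⟧ ≡ mkℚ (+ n) 0 (Coprime.sym (1-coprimeTo n))
  ⟦⟧-mkℚ n = normalize-coprime (Coprime.sym (1-coprimeTo n))

  ⟦⟧-homo-+ : ∀ a b → ⟦ a ℕ.+ b ⟧ ≡ ⟦ a ⟧ + ⟦ b ⟧
  ⟦⟧-homo-+ a b rewrite ⟦⟧-mkℚ a | ⟦⟧-mkℚ b =
    /-cong (sym (cong₂ ℤ._+_ (ℤ.*-identityʳ (+ a)) (ℤ.*-identityʳ (+ b)))) refl

  ⟦⟧-homo-* : ∀ a b → ⟦ a ℕ.* b ⟧ ≡ ⟦ a ⟧ * ⟦ b ⟧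
  ⟦⟧-homo-* a b rewrite ⟦⟧-mkℚ a | ⟦⟧-mkℚ b = /-cong (ℤ.pos-* a b) refl

  ⟦⟧-mono-≤ : ∀ {a b} → a ℕ.≤ b → ⟦ a ⟧ ≤ ⟦ b ⟧
  ⟦⟧-mono-≤ {a} {b} a≤b rewrite ⟦⟧-mkℚ a | ⟦⟧-mkℚ b =
    *≤* (subst₂ ℤ._≤_ (sym (ℤ.*-identityʳ (+ a))) (sym (ℤ.*-identityʳ (+ b))) (ℤ.+≤+ a≤b))

  ⟦⟧-nonNeg : ∀ n → NonNegative ⟦ n ⟧
  ⟦⟧-nonNeg n = nonNegative (⟦⟧-mono-≤ {0} {n} ℕ.z≤n)

  ⟦⟧-pos : ∀ n → Positive ⟦ suc n ⟧
  ⟦⟧-pos n rewrite ⟦⟧-mkℚ (suc n) = _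

  ≤-ε-of-deficit : ∀ (a c s N T n : ℕ) (ε ζ : ℚ) →
    a ℕ.+ c ℕ.* s ℕ.≤ c ℕ.* N → (1ℚ - ζ) * ⟦ N ⟧ ≤ ⟦ s ⟧ → ζ * ⟦ n ⟧ ≤ ε →
    n ℕ.* T ≡ c ℕ.* N → ⟦ a ⟧ ≤ ε * ⟦ T ⟧
  ≤-ε-of-deficit a c s N T n ε ζ a+cs≤cN few-unsat ζn≤ε nT≡cN = begin
    ⟦ a ⟧                                ≡⟨ solve 3 (λ a c s → a := a :+ c :* s :- c :* s) refl ⟦ a ⟧ ⟦ c ⟧ ⟦ s ⟧ ⟩
    ⟦ a ⟧ + ⟦ c ⟧ * ⟦ s ⟧ - ⟦ c ⟧ * ⟦ s ⟧  ≤⟨ +-monoˡ-≤ (- (⟦ c ⟧ * ⟦ s ⟧)) a+cs≤cN′ ⟩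
    ⟦ c ⟧ * ⟦ N ⟧ - ⟦ c ⟧ * ⟦ s ⟧          ≡⟨ solve 3 (λ c N s → c :* N :- c :* s := c :* (N :- s))
                                                   refl ⟦ c ⟧ ⟦ N ⟧ ⟦ s ⟧ ⟩
    ⟦ c ⟧ * (⟦ N ⟧ - ⟦ s ⟧)                ≤⟨ *-monoˡ-≤-nonNeg ⟦ c ⟧ {{⟦⟧-nonNeg c}}
                                                   (+-monoʳ-≤ ⟦ N ⟧ (neg-antimono-≤ few-unsat)) ⟩
    ⟦ c ⟧ * (⟦ N ⟧ - (1ℚ - ζ) * ⟦ N ⟧)     ≡⟨ solve 3 (λ c N z → c :* (N :- (con 1ℚ :- z) :* N) := z :* (c :* N))
                                                   refl ⟦ c ⟧ ⟦ N ⟧ ζ ⟩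
    ζ * (⟦ c ⟧ * ⟦ N ⟧)                    ≡⟨ cong (ζ *_) (trans (sym (⟦⟧-homo-* c N))
                                                   (trans (cong ⟦_⟧ (sym nT≡cN)) (⟦⟧-homo-* n T))) ⟩
    ζ * (⟦ n ⟧ * ⟦ T ⟧)                    ≡⟨ *-assoc ζ ⟦ n ⟧ ⟦ T ⟧ ⟨
    ζ * ⟦ n ⟧ * ⟦ T ⟧                      ≤⟨ *-monoʳ-≤-nonNeg ⟦ T ⟧ {{⟦⟧-nonNeg T}} ζn≤ε ⟩
    ε * ⟦ T ⟧                              ∎
    where
    open ≤-Reasoning
    a+cs≤cN′ : ⟦ a ⟧ + ⟦ c ⟧ * ⟦ s ⟧ ≤ ⟦ c ⟧ * ⟦ N ⟧
    a+cs≤cN′ = subst₂ _≤_ (trans (⟦⟧-homo-+ a (c ℕ.* s)) (cong (_+_ ⟦ a ⟧) (⟦⟧-homo-* c s)))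
                         (⟦⟧-homo-* c N) (⟦⟧-mono-≤ a+cs≤cN)

  ≤-ε-of-union-bound : ∀ (R b T m : ℕ) (ε : ℚ) → 0ℚ ≤ ε →
    R ℕ.* b ℕ.≤ m ℕ.* T → (R ≡ 0 → b ≡ 0) → ε * ⟦ R ⟧ ≡ ⟦ m ⟧ → ⟦ b ⟧ ≤ ε * ⟦ T ⟧
  ≤-ε-of-union-bound ℕ.zero b T m ε 0≤ε _ R≡0⇒b≡0 _ rewrite R≡0⇒b≡0 refl =
    subst (_≤ ε * ⟦ T ⟧) (*-zeroˡ ⟦ T ⟧) (*-monoʳ-≤-nonNeg ⟦ T ⟧ {{⟦⟧-nonNeg T}} 0≤ε)
  ≤-ε-of-union-bound (suc r) b T m ε _ Rb≤mT _ εR≡m =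
    *-cancelˡ-≤-pos ⟦ suc r ⟧ {{⟦⟧-pos r}} (begin
      ⟦ suc r ⟧ * ⟦ b ⟧      ≡⟨ ⟦⟧-homo-* (suc r) b ⟨
      ⟦ suc r ℕ.* b ⟧        ≤⟨ ⟦⟧-mono-≤ Rb≤mT ⟩
      ⟦ m ℕ.* T ⟧            ≡⟨ ⟦⟧-homo-* m T ⟩
      ⟦ m ⟧ * ⟦ T ⟧          ≡⟨ cong (_* ⟦ T ⟧) εR≡m ⟨
      ε * ⟦ suc r ⟧ * ⟦ T ⟧  ≡⟨ solve 3 (λ e R T → e :* R :* T := R :* (e :* T)) refl ε ⟦ suc r ⟧ ⟦ T ⟧ ⟩
      ⟦ suc r ⟧ * (ε * ⟦ T ⟧) ∎)
    where open ≤-Reasoning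

  ≤-2ε-of-+ : ∀ (a b c T : ℕ) (ε : ℚ) → a ℕ.≤ b ℕ.+ c → ⟦ b ⟧ ≤ ε * ⟦ T ⟧ → ⟦ c ⟧ ≤ ε * ⟦ T ⟧ →
              ⟦ a ⟧ ≤ ⟦ 2 ⟧ * ε * ⟦ T ⟧
  ≤-2ε-of-+ a b c T ε a≤b+c b≤εT c≤εT = begin
    ⟦ a ⟧                  ≤⟨ ⟦⟧-mono-≤ a≤b+c ⟩
    ⟦ b ℕ.+ c ⟧            ≡⟨ ⟦⟧-homo-+ b c ⟩
    ⟦ b ⟧ + ⟦ c ⟧          ≤⟨ +-mono-≤ b≤εT c≤εT ⟩
    ε * ⟦ T ⟧ + ε * ⟦ T ⟧  ≡⟨ solve 2 (λ e T → e :* T :+ e :* T := (con 1ℚ :+ con 1ℚ) :* e :* T)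
                                      refl ε ⟦ T ⟧ ⟩
    ⟦ 2 ⟧ * ε * ⟦ T ⟧      ∎
    where open ≤-Reasoning

  ≥-complement : ∀ (k s r T : ℕ) (δ : ℚ) → k ℕ.* s ℕ.+ r ≡ T → ⟦ r ⟧ ≤ δ * ⟦ T ⟧ →
                 (1ℚ - δ) * ⟦ T ⟧ ≤ ⟦ k ⟧ * ⟦ s ⟧
  ≥-complement k s r T δ ks+r≡T r≤δT = begin
    (1ℚ - δ) * ⟦ T ⟧           ≡⟨ solve 2 (λ d T → (con 1ℚ :- d) :* T := T :- d :* T) refl δ ⟦ T ⟧ ⟩
    ⟦ T ⟧ - δ * ⟦ T ⟧          ≤⟨ +-monoʳ-≤ ⟦ T ⟧ (neg-antimono-≤ r≤δT) ⟩
    ⟦ T ⟧ - ⟦ r ⟧              ≡⟨ cong (_- ⟦ r ⟧) (trans (cong ⟦_⟧ (sym ks+r≡T))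
                                    (trans (⟦⟧-homo-+ (k ℕ.* s) r) (cong (_+ ⟦ r ⟧) (⟦⟧-homo-* k s)))) ⟩
    ⟦ k ⟧ * ⟦ s ⟧ + ⟦ r ⟧ - ⟦ r ⟧  ≡⟨ solve 2 (λ x y → x :+ y :- y := x) refl (⟦ k ⟧ * ⟦ s ⟧) ⟦ r ⟧ ⟩
    ⟦ k ⟧ * ⟦ s ⟧              ∎
    where open ≤-Reasoning

module CyclicDistance where
  open import Data.Nat using (_+_; _∸_; _≤_; _<_; z≤n; s≤s)
  open import Data.Nat.DivMod using (_%_; m<n⇒m%n≡m; n%n≡0)
  open import Data.Nat.Properties
  open import Data.Sum using (inj₁; inj₂)
  open import Relation.Nullary using (yes; no; contradiction)
  open import Relation.Binary.PropositionalEquality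
  open import Relation.Binary.Definitions using (tri<; tri≈; tri>)

  -- number of steps a ↦ (a + 1) mod (1 + n) leading from a to b
  cycleDistance : ℕ → ℕ → ℕ → ℕ
  cycleDistance n a b with a ≤? b
  ... | yes _ = b ∸ a
  ... | no  _ = suc n + b ∸ a

  module _ {n a b : ℕ} where

    a≤b⇒cycleDistance≡b∸a : a ≤ b → cycleDistance n a b ≡ b ∸ a
    a≤b⇒cycleDistance≡b∸a a≤b with a ≤? b
    ... | yes _   = refl
    ... | no  a≰b = contradiction a≤b a≰b

    b<a⇒cycleDistance≡1+n+b∸a : b < a → cycleDistance n a b ≡ suc n + b ∸ a
    b<a⇒cycleDistance≡1+n+b∸a b<a with a ≤? b
    ... | yes a≤b = contradiction a≤b (<⇒≱ b<a)
    ... | no  _   = refl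

  cycleDistance≤n : ∀ n a {b} → b ≤ n → cycleDistance n a b ≤ n
  cycleDistance≤n n a {b} b≤n with a ≤? b
  ... | yes _   = ≤-trans (m∸n≤m b a) b≤n
  ... | no  a≰b = m≤n+o⇒m∸n≤o (suc n + b) a (begin
    suc n + b  ≡⟨ +-suc n b ⟨
    n + suc b  ≤⟨ +-monoʳ-≤ n (≰⇒> a≰b) ⟩
    n + a      ≡⟨ +-comm n a ⟩
    a + n      ∎)
    where open ≤-Reasoning

  cycleDistance-step : ∀ n {a b} → a ≤ n → b ≤ n → a ≢ b →
                       suc (cycleDistance n (suc a % suc n) b) ≡ cycleDistance n a b
  cycleDistance-step n {a} {b} a≤n b≤n a≢b with m≤n⇒m<n∨m≡n a≤n | <-cmp a b
  ... | _ | tri≈ _ a≡b _ = contradiction a≡b a≢b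
  ... | inj₁ a<n | tri< a<b _ _ rewrite m<n⇒m%n≡m {suc n} (s≤s a<n) = begin
    suc (cycleDistance n (suc a) b)  ≡⟨ cong suc (a≤b⇒cycleDistance≡b∸a a<b) ⟩
    suc (b ∸ suc a)                  ≡⟨ +-∸-assoc 1 a<b ⟨
    b ∸ a                            ≡⟨ a≤b⇒cycleDistance≡b∸a (<⇒≤ a<b) ⟨
    cycleDistance n a b              ∎
    where open ≡-Reasoning
  ... | inj₁ a<n | tri> _ _ b<a rewrite m<n⇒m%n≡m {suc n} (s≤s a<n) = begin
    suc (cycleDistance n (suc a) b)  ≡⟨ cong suc (b<a⇒cycleDistance≡1+n+b∸a (m<n⇒m<1+n b<a)) ⟩
    suc (suc n + b ∸ suc a)          ≡⟨ +-∸-assoc 1 (≤-trans (<⇒≤ a<n) (m≤m+n n b)) ⟨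
    suc n + b ∸ a                    ≡⟨ b<a⇒cycleDistance≡1+n+b∸a b<a ⟨
    cycleDistance n a b              ∎
    where open ≡-Reasoning
  ... | inj₂ refl | tri< a<b _ _ = contradiction b≤n (<⇒≱ a<b)
  ... | inj₂ refl | tri> _ _ b<a rewrite n%n≡0 (suc n) {{_}} = begin
    suc (cycleDistance n 0 b)  ≡⟨ cong suc (a≤b⇒cycleDistance≡b∸a {n} z≤n) ⟩
    suc b                      ≡⟨ m+n∸m≡n n (suc b) ⟨
    n + suc b ∸ n              ≡⟨ cong (_∸ n) (+-suc n b) ⟩
    suc n + b ∸ n              ≡⟨ b<a⇒cycleDistance≡1+n+b∸a b<a ⟨
    cycleDistance n n b        ∎
    where open ≡-Reasoning

module LabelingPartition (k t m L : ℕ) (U : UG) (ρ : Labeling U) where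
  open import Data.Bool using (Bool; true; false; _∧_; not; if_then_else_)
  open import Data.Empty using (⊥-elim)
  open import Data.Fin using (_≟_)
  open import Data.Fin.Properties using (¬Fin0)
  open import Data.Fin.Permutation using (_⟨$⟩ʳ_)
  open import Data.Maybe using (Maybe; just; nothing)
  open import Data.Nat using (_+_; _*_; _^_; _≤_; z≤n; s≤s)
  open import Data.Nat.Properties hiding (_≟_)
  open import Data.Nat.Solver using (module +-*-Solver)
  open import Data.Bool.Properties using (∧-identityʳ)
  open import Data.Product using (_×_; _,_; proj₁; proj₂)
  open import Function using (_∘_)
  open import Relation.Nullary using (¬_; does)
  open import Relation.Binary.PropositionalEquality
  open FiniteSums
  open Counting
  open +-*-Solver using (solve; _:=_; _:+_; _:*_; con)

  open UG U
  open HDVD k t m L U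
  open Labeling ρ

  validTuple : Fin nV → (Fin (2 * t) → Fin nW) → Bool
  validTuple v ws = allFin (2 * t) (λ i → E v (ws i))

  allSatisfied : Fin nV → (Fin (2 * t) → Fin nW) → Bool
  allSatisfied v ws = allFin (2 * t) (λ i → satB U ρ v (ws i))

  labelIn : (Fin m → Fin R) → Fin R → Bool
  labelIn S r = anyFin m (λ i → does (r ≟ S i))

  good : TV → Bool
  good τ = allSatisfied (TV.v τ) (TV.ws τ) ∧ not (labelIn (TV.S τ) (ρV (TV.v τ)))

  colour : TV → Fin k
  colour τ = TV.x τ (ρV (TV.v τ))

  partition : TV → Maybe (Fin k)
  partition τ = if good τ then just (colour τ) else nothing

  numUnsatisfied numLabelInS : ℕ
  numUnsatisfied = countT (λ τ → not (allSatisfied (TV.v τ) (TV.ws τ)))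
  numLabelInS    = countT (λ τ → labelIn (TV.S τ) (ρV (TV.v τ)))

  toTV : Fin L × (Fin R → Fin k) × (Fin m → Fin R) × Fin nV × (Fin (2 * t) → Fin nW) → TV
  toTV (l , x , S , v , ws) = tv l x S v ws

  vertexTuples-additive : Additive (Σfin nV ⊗ Σfun (2 * t) nW)
  vertexTuples-additive = ⊗-additive (Σfin-additive nV) (Σfun-additive (2 * t) nW)

  ΣTV-additive : Additive ΣTV
  ΣTV-additive = record
    { ∑-cong = λ f≗g → ∑-cong tuples (f≗g ∘ toTV)
    ; ∑-+    = λ f g → ∑-+ tuples (f ∘ toTV) (g ∘ toTV)
    }
    where
    tuples : Additive (Σfin L ⊗ Σfun R k ⊗ Σfun m R ⊗ Σfin nV ⊗ Σfun (2 * t) nW)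
    tuples = ⊗-additive (Σfin-additive L) (⊗-additive (Σfun-additive R k)
               (⊗-additive (Σfun-additive m R) vertexTuples-additive))

  Σ∖x : (Fin L × (Fin m → Fin R) × Fin nV × (Fin (2 * t) → Fin nW) → ℕ) → ℕ
  Σ∖x = Σfin L ⊗ Σfun m R ⊗ Σfin nV ⊗ Σfun (2 * t) nW

  Σ∖x-additive : Additive Σ∖x
  Σ∖x-additive = ⊗-additive (Σfin-additive L) (⊗-additive (Σfun-additive m R) vertexTuples-additive)

  Σ∖S : (Fin L × (Fin R → Fin k) × Fin nV × (Fin (2 * t) → Fin nW) → ℕ) → ℕ
  Σ∖S = Σfin L ⊗ Σfun R k ⊗ Σfin nV ⊗ Σfun (2 * t) nW

  Σ∖S-additive : Additive Σ∖S
  Σ∖S-additive = ⊗-additive (Σfin-additive L) (⊗-additive (Σfun-additive R k) vertexTuples-additive)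

  ΣTV-colours-inner : ∀ f → ΣTV f ≡ Σ∖x (λ (l , S , v , ws) → Σfun R k λ x → f (tv l x S v ws))
  ΣTV-colours-inner f = Σfin-cong L λ l →
    Σfun-comm (⊗-additive (Σfun-additive m R) vertexTuples-additive) R k (λ x (S , v , ws) → f (tv l x S v ws))

  ΣTV-subsets-inner : ∀ f → ΣTV f ≡ Σ∖S (λ (l , x , v , ws) → Σfun m R λ S → f (tv l x S v ws))
  ΣTV-subsets-inner f = Σfin-cong L λ l → Σfun-cong R k λ x →
    Σfun-comm vertexTuples-additive m R (λ S (v , ws) → f (tv l x S v ws))

  ΣTV-vertex-tuple : ∀ (h : Fin nV → (Fin (2 * t) → Fin nW) → ℕ) →
    ΣTV (λ τ → h (TV.v τ) (TV.ws τ)) ≡ L * (k ^ R * R ^ m) * Σfin nV (λ v → Σfun (2 * t) nW (h v))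
  ΣTV-vertex-tuple h = begin
    Σfin L (λ _ → Σfun R k (λ _ → Σfun m R (λ _ → H)))
                                                        ≡⟨ Σfin-cong L (λ _ → Σfun-cong R k (λ _ → Σfun-const m R H)) ⟩
    Σfin L (λ _ → Σfun R k (λ _ → R ^ m * H))           ≡⟨ Σfin-cong L (λ _ → Σfun-const R k (R ^ m * H)) ⟩
    Σfin L (λ _ → k ^ R * (R ^ m * H))                  ≡⟨ Σfin-const L _ ⟩
    L * (k ^ R * (R ^ m * H))                           ≡⟨ cong (L *_) (*-assoc (k ^ R) (R ^ m) H) ⟨
    L * (k ^ R * R ^ m * H)                             ≡⟨ *-assoc L (k ^ R * R ^ m) H ⟨
    L * (k ^ R * R ^ m) * H                             ∎
    where
    open ≡-Reasoning
    H : ℕ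
    H = Σfin nV (λ v → Σfun (2 * t) nW (h v))

  numLabelInS-unlabelled : R ≡ 0 → numLabelInS ≡ 0
  numLabelInS-unlabelled R≡0 =
    trans (∑-cong ΣTV-additive {f = λ τ → ind (validB τ ∧ labelIn (TV.S τ) (ρV (TV.v τ)))}
                  λ τ → ⊥-elim (¬Fin0 (subst Fin R≡0 (ρV (TV.v τ)))))
          (∑-0 ΣTV-additive)

  k*Σfun-0≡0 : ∀ n → k * Σfun n k (λ _ → 0) ≡ 0
  k*Σfun-0≡0 n = trans (cong (k *_) (∑-0 (Σfun-additive n k))) (*-zeroʳ k)

  colour-classes : ∀ (valid g : Bool) (r : Fin R) (j : Fin k) →
    k * Σfun R k (λ x → ind (valid ∧ isB j (if g then just (x r) else nothing)))
      + Σfun R k (λ x → ind (valid ∧ isNothingB (if g then just (x r) else nothing)))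
      ≡ Σfun R k (λ _ → ind (valid ∧ true))
  colour-classes false g     r j = cong (_+ Σfun R k (λ _ → 0)) (k*Σfun-0≡0 R)
  colour-classes true  false r j = cong (_+ Σfun R k (λ _ → 1)) (k*Σfun-0≡0 R)
  colour-classes true  true  r j = begin
    k * Σfun R k (λ x → ind (does (j ≟ x r))) + Σfun R k (λ _ → 0)
      ≡⟨ cong₂ _+_ (*-Σfun-coordinate R k (λ a → ind (does (j ≟ a))) r) (∑-0 (Σfun-additive R k)) ⟩
    k ^ R * Σfin k (λ a → ind (does (j ≟ a))) + 0
      ≡⟨ +-identityʳ _ ⟩
    k ^ R * Σfin k (λ a → ind (does (j ≟ a)))
      ≡⟨ cong (k ^ R *_) (Σfin-ind-≟ k j) ⟩
    k ^ R * 1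
      ≡⟨ Σfun-const R k 1 ⟨
    Σfun R k (λ _ → 1) ∎
    where open ≡-Reasoning

  k*sizeTj+sizeT'≡sizeT : ∀ j → k * sizeTj partition j + sizeT' partition ≡ sizeT
  k*sizeTj+sizeT'≡sizeT j = begin
    k * sizeTj partition j + sizeT' partition
      ≡⟨ cong₂ (λ a b → k * a + b) (ΣTV-colours-inner _) (ΣTV-colours-inner _) ⟩
    k * Σ∖x (λ (l , S , v , ws) → Σfun R k λ x → ind (validTuple v ws ∧ isB j (partition (tv l x S v ws))))
      + Σ∖x (λ (l , S , v , ws) → Σfun R k λ x → ind (validTuple v ws ∧ isNothingB (partition (tv l x S v ws))))
      ≡⟨ ∑-linear Σ∖x-additive k (λ (l , S , v , ws) →
           colour-classes (validTuple v ws) (allSatisfied v ws ∧ not (labelIn S (ρV v))) (ρV v) j) ⟩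
    Σ∖x (λ (l , S , v , ws) → Σfun R k λ x → ind (validTuple v ws ∧ true))
      ≡⟨ ΣTV-colours-inner _ ⟨
    sizeT ∎
    where
    open ≡-Reasoning

  unclassified-≤ : ∀ valid a b (c : Fin k) →
    ind (valid ∧ isNothingB (if a ∧ not b then just c else nothing)) ≤ ind (valid ∧ not a) + ind (valid ∧ b)
  unclassified-≤ false a     b     c = z≤n
  unclassified-≤ true  true  true  c = ≤-refl
  unclassified-≤ true  true  false c = z≤n
  unclassified-≤ true  false b     c = s≤s z≤n

  sizeT'≤numUnsatisfied+numLabelInS : sizeT' partition ≤ numUnsatisfied + numLabelInS
  sizeT'≤numUnsatisfied+numLabelInS =
    ≤-trans (∑-mono ΣTV-additive λ τ → unclassified-≤ (validB τ) _ _ (colour τ)) (≤-reflexive (∑-+ ΣTV-additive _ _))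

  R*numLabelInS≤m*sizeT : R * numLabelInS ≤ m * sizeT
  R*numLabelInS≤m*sizeT = begin
    R * numLabelInS
      ≡⟨ cong (R *_) (ΣTV-subsets-inner _) ⟩
    R * Σ∖S (λ (l , x , v , ws) → Σfun m R λ S → ind (validTuple v ws ∧ labelIn S (ρV v)))
      ≤⟨ *-∑-mono Σ∖S-additive R m (λ (l , x , v , ws) → pointwise (validTuple v ws) (ρV v)) ⟩
    m * Σ∖S (λ (l , x , v , ws) → Σfun m R λ S → ind (validTuple v ws ∧ true))
      ≡⟨ cong (m *_) (ΣTV-subsets-inner _) ⟨
    m * sizeT ∎
    where
    open ≤-Reasoning
    pointwise : ∀ valid r → R * Σfun m R (λ S → ind (valid ∧ labelIn S r)) ≤ m * Σfun m R (λ _ → ind (valid ∧ true))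
    pointwise false r = ≤-trans (≤-reflexive (trans (cong (R *_) (∑-0 (Σfun-additive m R))) (*-zeroʳ R))) z≤n
    pointwise true  r = begin
      R * Σfun m R (λ S → ind (labelIn S r))           ≤⟨ *-Σfun-ind-anyFin-≤ m R (λ a → does (r ≟ a)) ⟩
      m * (R ^ m * Σfin R (λ a → ind (does (r ≟ a))))  ≡⟨ cong (λ c → m * (R ^ m * c)) (Σfin-ind-≟ R r) ⟩
      m * (R ^ m * 1)                                  ≡⟨ cong (m *_) (Σfun-const m R 1) ⟨
      m * Σfun m R (λ _ → 1)                           ∎

  satisfiedDegree unsatisfiedDegree unsatisfiedTuples : Fin nV → ℕ
  satisfiedDegree   v = Σfin nW (λ w → ind (E v w ∧ satB U ρ v w))
  unsatisfiedDegree v = Σfin nW (λ w → ind (E v w ∧ not (satB U ρ v w)))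
  unsatisfiedTuples v = Σfun (2 * t) nW (λ ws → ind (validTuple v ws ∧ not (allSatisfied v ws)))

  satisfied+unsatisfied : ∀ v → satisfiedDegree v + unsatisfiedDegree v ≡ degV U v
  satisfied+unsatisfied v = begin
    satisfiedDegree v + unsatisfiedDegree v  ≡⟨ +-comm (satisfiedDegree v) _ ⟩
    unsatisfiedDegree v + satisfiedDegree v  ≡⟨ Σfin-+ nW _ _ ⟨
    Σfin nW (λ w → ind (E v w ∧ not (satB U ρ v w)) + ind (E v w ∧ satB U ρ v w))
                                             ≡⟨ Σfin-cong nW (λ w → ind-∧-not-+ (E v w) (satB U ρ v w)) ⟩
    degV U v                                 ∎
    where open ≡-Reasoning

  unsatisfiedTuples+satisfied^ : ∀ v →
    unsatisfiedTuples v + satisfiedDegree v ^ (2 * t) ≡ degV U v ^ (2 * t)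
  unsatisfiedTuples+satisfied^ v = begin
    unsatisfiedTuples v + satisfiedDegree v ^ (2 * t)
      ≡⟨ cong (unsatisfiedTuples v +_) (Σfun-ind-allFin (2 * t) nW (λ w → E v w ∧ satB U ρ v w)) ⟨
    unsatisfiedTuples v + Σfun (2 * t) nW (λ ws → ind (allFin (2 * t) (λ i → E v (ws i) ∧ satB U ρ v (ws i))))
      ≡⟨ cong (unsatisfiedTuples v +_)
              (Σfun-cong (2 * t) nW λ ws → cong ind (allFin-∧ (2 * t) _ _)) ⟨
    unsatisfiedTuples v + Σfun (2 * t) nW (λ ws → ind (validTuple v ws ∧ allSatisfied v ws))
      ≡⟨ Σfun-+ (2 * t) nW _ _ ⟨
    Σfun (2 * t) nW (λ ws → ind (validTuple v ws ∧ not (allSatisfied v ws)) + ind (validTuple v ws ∧ allSatisfied v ws))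
      ≡⟨ Σfun-cong (2 * t) nW (λ ws → ind-∧-not-+ (validTuple v ws) (allSatisfied v ws)) ⟩
    Σfun (2 * t) nW (λ ws → ind (validTuple v ws))
      ≡⟨ Σfun-ind-allFin (2 * t) nW (E v) ⟩
    degV U v ^ (2 * t) ∎
    where open ≡-Reasoning

  module WithRegularDegree (dV : ℕ) (regular : ∀ v → degV U v ≡ dV) (e : ℕ) (2t≡1+e : 2 * t ≡ suc e) where

    c₀ c : ℕ
    c₀ = suc e * dV ^ e
    c  = L * (k ^ R * R ^ m) * c₀

    unsatisfiedTuples-≤ : ∀ v → unsatisfiedTuples v + c₀ * satisfiedDegree v ≤ c₀ * degV U v
    unsatisfiedTuples-≤ v = begin
      b + c₀ * s                    ≡⟨ cong (λ d → b + suc e * d ^ e * s) s+u≡dV ⟨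
      b + suc e * (s + u) ^ e * s   ≤⟨ ^-deficit-≤ e s u b b+s^≡[s+u]^ ⟩
      suc e * (s + u) ^ e * (s + u) ≡⟨ cong (λ d → suc e * d ^ e * d) s+u≡dV ⟩
      c₀ * dV                       ≡⟨ cong (c₀ *_) (regular v) ⟨
      c₀ * degV U v                 ∎
      where
      open ≤-Reasoning
      b s u : ℕ
      b = unsatisfiedTuples v
      s = satisfiedDegree v
      u = unsatisfiedDegree v
      s+u≡dV : s + u ≡ dV
      s+u≡dV = trans (satisfied+unsatisfied v) (regular v)
      b+s^≡[s+u]^ : b + s ^ suc e ≡ (s + u) ^ suc e
      b+s^≡[s+u]^ = subst (λ n → b + s ^ n ≡ (s + u) ^ n) 2t≡1+e
        (trans (unsatisfiedTuples+satisfied^ v) (cong (_^ (2 * t)) (sym (satisfied+unsatisfied v))))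

    numUnsatisfied-≤ : numUnsatisfied + c * numSat U ρ ≤ c * numEdges U
    numUnsatisfied-≤ = begin
      numUnsatisfied + c * numSat U ρ
        ≡⟨ cong (_+ c * numSat U ρ) (ΣTV-vertex-tuple _) ⟩
      K * Σfin nV unsatisfiedTuples + K * c₀ * numSat U ρ
        ≡⟨ cong (K * Σfin nV unsatisfiedTuples +_) (*-assoc K c₀ _) ⟩
      K * Σfin nV unsatisfiedTuples + K * (c₀ * numSat U ρ)
        ≡⟨ *-distribˡ-+ K _ _ ⟨
      K * (Σfin nV unsatisfiedTuples + c₀ * numSat U ρ)
        ≤⟨ *-monoʳ-≤ K Σ-unsatisfiedTuples-≤ ⟩
      K * (c₀ * numEdges U)
        ≡⟨ *-assoc K c₀ _ ⟨
      c * numEdges U ∎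
      where
      open ≤-Reasoning
      K : ℕ
      K = L * (k ^ R * R ^ m)
      Σ-unsatisfiedTuples-≤ : Σfin nV unsatisfiedTuples + c₀ * numSat U ρ ≤ c₀ * numEdges U
      Σ-unsatisfiedTuples-≤ = begin
        Σfin nV unsatisfiedTuples + c₀ * numSat U ρ
          ≡⟨ +-comm (Σfin nV unsatisfiedTuples) _ ⟩
        c₀ * Σfin nV satisfiedDegree + Σfin nV unsatisfiedTuples
          ≡⟨ ∑-linear (Σfin-additive nV) c₀ (λ v → refl) ⟩
        Σfin nV (λ v → c₀ * satisfiedDegree v + unsatisfiedTuples v)
          ≤⟨ ∑-mono (Σfin-additive nV) (λ v →
               ≤-trans (≤-reflexive (+-comm (c₀ * satisfiedDegree v) _)) (unsatisfiedTuples-≤ v)) ⟩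
        Σfin nV (λ v → c₀ * degV U v)
          ≡⟨ *-distribˡ-∑ (Σfin-additive nV) c₀ (degV U) ⟨
        c₀ * numEdges U ∎

    2t*sizeT≡c*numEdges : 2 * t * sizeT ≡ c * numEdges U
    2t*sizeT≡c*numEdges = begin
      2 * t * sizeT                         ≡⟨ cong (2 * t *_) (ΣTV-vertex-tuple _) ⟩
      2 * t * (K * Σfin nV (λ v → Σfun (2 * t) nW (λ ws → ind (validTuple v ws ∧ true))))
        ≡⟨ cong (λ X → 2 * t * (K * X)) (Σfin-cong nV valid-count) ⟩
      2 * t * (K * Σfin nV (λ _ → dV ^ (2 * t)))
        ≡⟨ cong (λ X → 2 * t * (K * X)) (Σfin-const nV _) ⟩
      2 * t * (K * (nV * dV ^ (2 * t)))     ≡⟨ cong (λ n → n * (K * (nV * dV ^ n))) 2t≡1+e ⟩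
      suc e * (K * (nV * (dV * dV ^ e)))
        ≡⟨ solve 5 (λ e K nV dV P → (con 1 :+ e) :* (K :* (nV :* (dV :* P))) := K :* ((con 1 :+ e) :* P) :* (nV :* dV))
                 refl e K nV dV (dV ^ e) ⟩
      c * (nV * dV)                         ≡⟨ cong (c *_) (trans (Σfin-cong nV regular) (Σfin-const nV dV)) ⟨
      c * numEdges U                        ∎
      where
      open ≡-Reasoning
      K : ℕ
      K = L * (k ^ R * R ^ m)
      valid-count : ∀ v → Σfun (2 * t) nW (λ ws → ind (validTuple v ws ∧ true)) ≡ dV ^ (2 * t)
      valid-count v = begin
        Σfun (2 * t) nW (λ ws → ind (validTuple v ws ∧ true))
                                                               ≡⟨ Σfun-cong (2 * t) nW (λ ws → cong ind (∧-identityʳ _)) ⟩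
        Σfun (2 * t) nW (λ ws → ind (validTuple v ws))         ≡⟨ Σfun-ind-allFin (2 * t) nW (E v) ⟩
        degV U v ^ (2 * t)                                     ≡⟨ cong (_^ (2 * t)) (regular v) ⟩
        dV ^ (2 * t)                                           ∎

  partition≡just : ∀ τ {c} → partition τ ≡ just c → good τ ≡ true × colour τ ≡ c
  partition≡just τ eq with good τ
  partition≡just τ refl | true = refl , refl

  good⇒satisfied : ∀ τ → good τ ≡ true → ∀ i →
                   ρV (TV.v τ) ≡ π (TV.v τ) (TV.ws τ i) ⟨$⟩ʳ ρW (TV.ws τ i)
  good⇒satisfied τ good-τ i =
    does-true (_ ≟ _) (allFin-true (2 * t) (proj₁ (∧-true good-τ)) i)

  good⇒label∉S : ∀ τ → good τ ≡ true → ¬ InS (TV.S τ) (ρV (TV.v τ))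
  good⇒label∉S τ good-τ (i , Si≡r) =
    does-false (_ ≟ _) (anyFin-false m (not-true (proj₂ (∧-true good-τ))) i) (sym Si≡r)

  InC-at-labels : ∀ {z x S v w} → InC z x S v w → ρV v ≡ π v w ⟨$⟩ʳ ρW w → ¬ InS S (ρV v) →
                  z (ρW w) ≡ x (ρV v)
  InC-at-labels {z} {x} {S} z∈C satisfied ρv∉S =
    trans (z∈C _ (subst (¬_ ∘ InS S) satisfied ρv∉S)) (cong x (sym satisfied))

  vertexColour : Vertex → Fin k
  vertexColour (bit _ w z) = z (ρW w)
  vertexColour (test τ)    = colour τ

  arc-into-good : ∀ {ℓ w z τ} → Arc (bit ℓ w z) (test τ) → good τ ≡ true → vertexColour (bit ℓ w z) ≡ colour τ
  arc-into-good {τ = τ} (i , refl , _ , z∈C) good-τ =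
    InC-at-labels {x = TV.x τ} z∈C (good⇒satisfied τ good-τ i) (good⇒label∉S τ good-τ)

  arc-out-of-good : ∀ {ℓ w z τ} → Arc (test τ) (bit ℓ w z) → good τ ≡ true →
                    vertexColour (bit ℓ w z) ≡ inc (colour τ)
  arc-out-of-good {τ = τ} (i , refl , _ , z′ , z′∈C , z≡z′+1) good-τ =
    trans (z≡z′+1 _)
          (cong inc (InC-at-labels {x = TV.x τ} z′∈C (good⇒satisfied τ good-τ i) (good⇒label∉S τ good-τ)))

module ShortPaths (n t m L : ℕ) (U : UG) (ρ : Labeling U) (j : Fin (suc n)) where
  open import Data.Bool using (true)
  open import Data.Fin using (toℕ)
  open import Data.Fin.Properties using (toℕ-injective; toℕ-fromℕ<; toℕ≤pred[n])
  open import Data.List using ([]; _∷_)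
  open import Data.Nat using (_≤_; z≤n; s≤s)
  open import Data.Nat.DivMod using (m%n<n)
  open import Data.Nat.Properties using (≤-trans; 1+n≰n; module ≤-Reasoning)
  open import Data.Product using (_×_; _,_; proj₁; proj₂)
  open import Function using (_∘_)
  open import Relation.Nullary using (¬_)
  open import Relation.Binary.PropositionalEquality
  open HDVD (suc n) t m L U
  open LabelingPartition (suc n) t m L U ρ
  open CyclicDistance

  Kept : TV → Set
  Kept = KeptAfterDeleting partition j

  kept⇒good : ∀ τ → Kept τ → good τ ≡ true × colour τ ≢ j
  kept⇒good τ (_ , j′ , partition-τ≡j′ , j′≢j) with partition≡just τ partition-τ≡j′
  ... | good-τ , refl = good-τ , j′≢j

  distance : Fin (suc n) → ℕ
  distance c = cycleDistance n (toℕ c) (toℕ j)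

  distance≤n : ∀ c → distance c ≤ n
  distance≤n c = cycleDistance≤n n (toℕ c) (toℕ≤pred[n] j)

  distance-inc : ∀ c → c ≢ j → suc (distance (inc c)) ≡ distance c
  distance-inc c c≢j =
    trans (cong (λ a → suc (cycleDistance n a (toℕ j))) (toℕ-fromℕ< (m%n<n (suc (toℕ c)) (suc n))))
          (cycleDistance-step n (toℕ≤pred[n] c) (toℕ≤pred[n] j) (c≢j ∘ toℕ-injective))

  tests≤distance : ∀ u ps → Consecutive (u ∷ ps) → AllIn Kept (u ∷ ps) →
                   numTests (u ∷ ps) ≤ distance (vertexColour u)
  tests≤distance (bit _ _ _) []                _          _ = z≤n
  tests≤distance (bit _ _ _) (bit _ _ _ ∷ _)   (() , _)   _
  tests≤distance (bit ℓ w z) (test τ ∷ ps)     (arc , cs) kept@(kept-τ , _) =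
    subst (λ c → numTests (test τ ∷ ps) ≤ distance c)
          (sym (arc-into-good {ℓ} {w} {z} {τ} arc (proj₁ (kept⇒good τ kept-τ))))
          (tests≤distance (test τ) ps cs kept)
  tests≤distance (test τ)    []                _          (kept-τ , _) =
    subst (1 ≤_) (distance-inc (colour τ) (proj₂ (kept⇒good τ kept-τ))) (s≤s z≤n)
  tests≤distance (test _)    (test _ ∷ _)      (() , _)   _
  tests≤distance (test τ)    (bit ℓ w z ∷ ps)  (arc , cs) (kept-τ , kept) = begin
    suc (numTests (bit ℓ w z ∷ ps))  ≤⟨ s≤s (tests≤distance (bit ℓ w z) ps cs kept) ⟩
    suc (distance (vertexColour (bit ℓ w z)))
      ≡⟨ cong (suc ∘ distance) (arc-out-of-good {ℓ} {w} {z} {τ} arc good-τ) ⟩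
    suc (distance (inc (colour τ)))  ≡⟨ distance-inc (colour τ) colour≢j ⟩
    distance (colour τ)              ∎
    where
    open ≤-Reasoning
    good-τ : good τ ≡ true
    good-τ = proj₁ (kept⇒good τ kept-τ)
    colour≢j : colour τ ≢ j
    colour≢j = proj₂ (kept⇒good τ kept-τ)

  kept-paths-short : (p : PathIn Kept) → ¬ (suc n ≤ numTests (PathIn.vertices p))
  kept-paths-short record { vertices = [] } ()
  kept-paths-short record { vertices = u ∷ ps ; arcs = cs ; inside = kept } long =
    1+n≰n (≤-trans long (≤-trans (tests≤distance u ps cs kept) (distance≤n (vertexColour u))))

open import Data.Maybe using (Maybe)
open import Data.Nat using (_≤_; s≤s) renaming (_*_ to _*ℕ_)
open import Data.Product using (Σ; _×_; _,_)
open import Data.Rational using (ℚ; _<_; _*_; _-_; 0ℚ; 1ℚ) renaming (_≤_ to _≤ℚ_)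
import Data.Rational.Properties as ℚ
open import Relation.Nullary using (¬_)
open import Relation.Binary.PropositionalEquality using (_≡_; refl)

lemma3 : (k : ℕ) → 2 ≤ k → (ε δ : ℚ) → 0ℚ < ε → 0ℚ < δ →
         (t : ℕ) → 1 ≤ t → (ζ : ℚ) → 0ℚ ≤ℚ ζ →
         ζ * ⟦ 2 *ℕ t ⟧ ≤ℚ ε →
         (L : ℕ) → 1 ≤ L →
         (U : UG) → Regular U →
         (m : ℕ) → ε * ⟦ UG.R U ⟧ ≡ ⟦ m ⟧ →
         (ρ : Labeling U) →
         (1ℚ - ζ) * ⟦ numEdges U ⟧ ≤ℚ ⟦ numSat U ρ ⟧ →
         Σ (HDVD.TV k t m L U → Maybe (Fin k)) λ part →
           ((j : Fin k) →
              (1ℚ - ⟦ 2 ⟧ * ε) * ⟦ HDVD.sizeT k t m L U ⟧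
                ≤ℚ ⟦ k ⟧ * ⟦ HDVD.sizeTj k t m L U part j ⟧)
           × ⟦ HDVD.sizeT' k t m L U part ⟧
               ≤ℚ ⟦ 2 ⟧ * ε * ⟦ HDVD.sizeT k t m L U ⟧
           × ((j : Fin k) →
                (p : HDVD.PathIn k t m L U (HDVD.KeptAfterDeleting k t m L U part j)) →
                ¬ (k ≤ HDVD.numTests k t m L U (HDVD.PathIn.vertices p)))
lemma3 k@(suc n) (s≤s _) ε _ 0<ε _ t@(suc _) (s≤s _) ζ _ ζ2t≤ε L _ U (dV , _ , regular , _) m εR≡m ρ
       many-satisfied =
  partition ,
  (λ j → ≥-complement k (sizeTj partition j) (sizeT' partition) sizeT (⟦ 2 ⟧ * ε)
                      (k*sizeTj+sizeT'≡sizeT j) sizeT'≤2εT) ,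
  sizeT'≤2εT ,
  ShortPaths.kept-paths-short n t m L U ρ
  where
  open HDVD k t m L U
  open LabelingPartition k t m L U ρ
  open WithRegularDegree dV regular _ refl
  open NaturalsInRationals

  numUnsatisfied≤εT : ⟦ numUnsatisfied ⟧ ≤ℚ ε * ⟦ sizeT ⟧
  numUnsatisfied≤εT = ≤-ε-of-deficit numUnsatisfied c (numSat U ρ) (numEdges U) sizeT (2 *ℕ t) ε ζ
                        numUnsatisfied-≤ many-satisfied ζ2t≤ε 2t*sizeT≡c*numEdges

  numLabelInS≤εT : ⟦ numLabelInS ⟧ ≤ℚ ε * ⟦ sizeT ⟧
  numLabelInS≤εT = ≤-ε-of-union-bound (UG.R U) numLabelInS sizeT m ε (ℚ.<⇒≤ 0<ε)
                     R*numLabelInS≤m*sizeT numLabelInS-unlabelled εR≡m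

  sizeT'≤2εT : ⟦ sizeT' partition ⟧ ≤ℚ ⟦ 2 ⟧ * ε * ⟦ sizeT ⟧
  sizeT'≤2εT = ≤-2ε-of-+ (sizeT' partition) numUnsatisfied numLabelInS sizeT ε
                 sizeT'≤numUnsatisfied+numLabelInS numUnsatisfied≤εT numLabelInS≤εT
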